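{- Let $D$ be an atomic half-factorial monoid and $H\subset D$ an atomic saturated submonoid. Then $\rho(H,D)\le1$.
   Context: Monoids are commutative cancellative with identity; atomic: every non-unit is a product of atoms; half-factorial: all factorizations of a non-unit have the same length. For $a$ in a monoid $M$, $\mathsf L_M(a)$ is its set of factorization lengths in $M$. $H\subset D$ is saturated if $a,b\in H$ and $a\mid b$ in $D$ imply $a\mid b$ in $H$. For an atomic submonoid $H$ of an atomic monoid $D$, $\rho(H,D)=\sup\{\min\mathsf L_H(a)/\min\mathsf L_D(a)\mid a\in H\setminus D^\times\}\in\mathbb R_{\ge0}\cup\{\infty\}$. -}

module Defs where

open import Level using (Level; _⊔_)
open import Algebra.Bundles using (CommutativeMonoid)
open import Data.Nat using (ℕ; _≤_)
open import Data.List using (List; foldr; length)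
open import Data.List.Relation.Unary.All using (All)
open import Data.Product using (Σ; ∃; _×_; _,_)
open import Data.Sum using (_⊎_)
open import Relation.Binary.PropositionalEquality using (_≡_)
open import Relation.Nullary using (¬_)
open import Relation.Unary using (Pred; _∈_; U)

-- Notions "in H" for a submonoid H ⊆ D are given for a predicate P on D's carrier;
-- the notions "in D" are the special case P = U (the full predicate).
module _ {c ℓ} (D : CommutativeMonoid c ℓ) where
  open CommutativeMonoid D renaming (Carrier to A)

  Cancellative : Set (c ⊔ ℓ)
  Cancellative = ∀ a b d → a ∙ b ≈ a ∙ d → b ≈ d

  prod : List A → A
  prod = foldr _∙_ ε

  IsSubmonoid : ∀ {p} → Pred A p → Set (c ⊔ ℓ ⊔ p)
  IsSubmonoid P = (ε ∈ P) × (∀ a b → a ∈ P → b ∈ P → (a ∙ b) ∈ P)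
                  × (∀ a b → a ≈ b → a ∈ P → b ∈ P)

  module _ {p} (P : Pred A p) where
    UnitIn : A → Set (c ⊔ ℓ ⊔ p)
    UnitIn u = (u ∈ P) × ∃ λ v → (v ∈ P) × (u ∙ v ≈ ε)

    AtomIn : A → Set (c ⊔ ℓ ⊔ p)
    AtomIn a = (a ∈ P) × ¬ UnitIn a
             × (∀ b d → b ∈ P → d ∈ P → a ≈ b ∙ d → UnitIn b ⊎ UnitIn d)

    LengthIn : A → ℕ → Set (c ⊔ ℓ ⊔ p)
    LengthIn a n = ∃ λ (xs : List A) → All AtomIn xs × (prod xs ≈ a) × (length xs ≡ n)

    IsMinLength : A → ℕ → Set (c ⊔ ℓ ⊔ p)
    IsMinLength a n = LengthIn a n × (∀ m → LengthIn a m → n ≤ m)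

    AtomicIn : Set (c ⊔ ℓ ⊔ p)
    AtomicIn = ∀ a → a ∈ P → ¬ UnitIn a → ∃ λ n → LengthIn a n

  HalfFactorial : Set (c ⊔ ℓ)
  HalfFactorial = AtomicIn U × (∀ a m n → LengthIn U a m → LengthIn U a n → m ≡ n)

  Saturated : ∀ {p} → Pred A p → Set (c ⊔ ℓ ⊔ p)
  Saturated P = ∀ a b → a ∈ P → b ∈ P → (∃ λ d → b ≈ a ∙ d)
                → ∃ λ d → (d ∈ P) × (b ≈ a ∙ d)

  -- ρ(H,D) ≤ 1, i.e. sup { min L_H(a) / min L_D(a) | a ∈ H ∖ D^× } ≤ 1,
  -- i.e. min L_H(a) ≤ min L_D(a) for every a ∈ H ∖ D^×.
  RhoAtMostOne : ∀ {p} → Pred A p → Set (c ⊔ ℓ ⊔ p)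
  RhoAtMostOne P = ∀ a → a ∈ P → ¬ UnitIn U a →
                   ∀ m n → IsMinLength P a m → IsMinLength U a n → m ≤ n

{-# OPTIONS --safe #-}
module Submission where

open import Defs
open import Algebra.Bundles using (CommutativeMonoid)
open import Relation.Unary using (Pred; U; _∈_)
open import Relation.Nullary using (¬_)
open import Data.Nat using (_≤_; _+_; s≤s; z≤n)
open import Data.Nat.Properties using (+-mono-≤; ≤-trans; ≤-reflexive)
open import Data.List using ([]; _∷_; _++_; length)
open import Data.List.Properties using (length-++)
open import Data.List.Relation.Unary.All using (All; []; _∷_)
open import Data.List.Relation.Unary.All.Properties using (++⁺)
open import Data.Product using (∃; _×_; _,_)
open import Data.Unit using (tt)
open import Data.Empty using (⊥-elim)
open import Function using (_∘_)
import Relation.Binary.PropositionalEquality as ≡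

-- An atom of a saturated submonoid H stays a non-unit in D, so in the half-factorial
-- monoid D it splits into at least one atom. Refining a factorization of a ∈ H of
-- length m atom by atom thus gives a factorization of a in D of length ≥ m, and every
-- factorization in D has length min L_D(a).

module _ {c ℓ} (D : CommutativeMonoid c ℓ) where
  open CommutativeMonoid D renaming (Carrier to A)

  prod-++ : ∀ xs ys → prod D (xs ++ ys) ≈ prod D xs ∙ prod D ys
  prod-++ [] ys = sym (identityˡ _)
  prod-++ (x ∷ xs) ys = trans (∙-congˡ (prod-++ xs ys)) (sym (assoc _ _ _))

  ≈ε⇒unit : ∀ {x} → x ≈ ε → UnitIn D U x
  ≈ε⇒unit x≈ε = tt , ε , tt , trans (∙-congʳ x≈ε) (identityˡ ε)

  saturated⇒unit-reflecting : ∀ {p} {H : Pred A p} → IsSubmonoid D H → Saturated D H →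
                              ∀ {x} → x ∈ H → UnitIn D U x → UnitIn D H x
  saturated⇒unit-reflecting (ε∈H , _) sat {x} x∈H (_ , v , _ , xv≈ε)
    with sat x ε x∈H ε∈H (v , sym xv≈ε)
  ... | d , d∈H , ε≈xd = x∈H , d , d∈H , sym ε≈xd

  saturated-atom⇒nonunit : ∀ {p} {H : Pred A p} → IsSubmonoid D H → Saturated D H →
                           ∀ {x} → AtomIn D H x → ¬ UnitIn D U x
  saturated-atom⇒nonunit sub sat (x∈H , x-nonunit , _) =
    x-nonunit ∘ saturated⇒unit-reflecting sub sat x∈H

  module _ {p} (P : Pred A p) where

    LengthIn-resp-≈ : ∀ {a b k} → a ≈ b → LengthIn D P a k → LengthIn D P b k
    LengthIn-resp-≈ a≈b (xs , atoms , xs≈a , len) = xs , atoms , trans xs≈a a≈b , len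

    nonunit⇒length-pos : ∀ {x k} → ¬ UnitIn D U x → LengthIn D P x k → 1 ≤ k
    nonunit⇒length-pos x-nonunit ([] , _ , ε≈x , _) = ⊥-elim (x-nonunit (≈ε⇒unit (sym ε≈x)))
    nonunit⇒length-pos _ (_ ∷ _ , _ , _ , ≡.refl) = s≤s z≤n

    concat-factorizations : ∀ {q} {Q : Pred A q} →
                            (∀ {x} → Q x → ∃ λ k → 1 ≤ k × LengthIn D P x k) →
                            ∀ {xs} → All Q xs → ∃ λ k → length xs ≤ k × LengthIn D P (prod D xs) k
    concat-factorizations refine [] = 0 , z≤n , [] , [] , refl , ≡.refl
    concat-factorizations refine (qx ∷ qxs)
      with refine qx | concat-factorizations refine qxs
    ... | k , 1≤k , ys , ys-atoms , ys≈x , ≡.refl | l , n≤l , zs , zs-atoms , zs≈xs , ≡.refl =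
      k + l , +-mono-≤ 1≤k n≤l ,
      ys ++ zs , ++⁺ ys-atoms zs-atoms , trans (prod-++ ys zs) (∙-cong ys≈x zs≈xs) , length-++ ys

  saturated-atom⇒factorization : ∀ {p} {H : Pred A p} → AtomicIn D U →
                                 IsSubmonoid D H → Saturated D H →
                                 ∀ {x} → AtomIn D H x → ∃ λ k → 1 ≤ k × LengthIn D U x k
  saturated-atom⇒factorization atomic sub sat {x} atom
    with atomic x tt (saturated-atom⇒nonunit sub sat atom)
  ... | k , x-length-k =
    k , nonunit⇒length-pos U (saturated-atom⇒nonunit sub sat atom) x-length-k , x-length-k

lemma3p12 : ∀ {c ℓ p} (D : CommutativeMonoid c ℓ) → Cancellative D → HalfFactorial D →
    (H : Pred (CommutativeMonoid.Carrier D) p) → IsSubmonoid D H →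
    AtomicIn D H → Saturated D H → RhoAtMostOne D H
lemma3p12 D _ (atomic , equal-lengths) H sub _ sat a _ _ _ n
          ((xs , atoms , xs≈a , ≡.refl) , _) (a-length-n , _)
  with concat-factorizations D U (saturated-atom⇒factorization D atomic sub sat) atoms
... | k , m≤k , xs-length-k =
  ≤-trans m≤k (≤-reflexive (equal-lengths a k n (LengthIn-resp-≈ D U xs≈a xs-length-k) a-length-n))
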